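{- Let $\Gamma$ be a finite set of linear arithmetic atoms over the rationals (equalities $0=t$, weak inequalities $0\le t$ and strict inequalities $0<t$, with $t$ linear terms) that is unsatisfiable over $\mathbb Q$, and let $S=\{0<t_1,\dots,0<t_n\}$ be the strict inequalities of $\Gamma$. Let $\varepsilon$ be a fresh symbol, $S_\varepsilon = \{\varepsilon\le t_1,\dots,\varepsilon\le t_n\}$ and $\Gamma_\varepsilon = (\Gamma\cup S_\varepsilon)\setminus S$. Let $\Gamma$ be partitioned into $A$ and $B$, and let $A_\varepsilon$, $B_\varepsilon$ be obtained from $A$ and $B$ by replacing each atom of $S$ by the corresponding atom of $S_\varepsilon$. Let $I_\varepsilon$ be an interpolant for $(A_\varepsilon,B_\varepsilon)$ computed by the proof-based method from an $\mathcal{LA}(\mathbb Q)$-proof of unsatisfiability of $A_\varepsilon\wedge B_\varepsilon$ in which $\varepsilon$ is treated symbolically as a positive infinitesimal. Then: (1) if $\varepsilon$ does not occur in $I_\varepsilon$, then $I_\varepsilon$ is an interpolant for $(A,B)$; (2) if $\varepsilon$ occurs in $I_\varepsilon$, then $I_\varepsilon$ is of the form $(0\le t - c\,\varepsilon)$ for some linear term $t$ not containing $\varepsilon$ and some rational $c>0$, and $I = (0<t)$ is an interpolant for $(A,B)$.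
   Context: An interpolant for a pair $(A,B)$ of formulas with $A\wedge B$ unsatisfiable is a formula $I$ such that $A\models I$, $I\wedge B$ is unsatisfiable, and every variable (non-interpreted symbol) of $I$ occurs both in $A$ and in $B$. An $\mathcal{LA}(\mathbb Q)$-proof is a derivation tree whose leaves are atoms of the input, built with the rules: from $0=t$ derive $0\le t$ (and $0\le -t$); from $0\le t_1$ and $0\le t_2$ derive $0\le c_1t_1+c_2t_2$ for rational $c_1,c_2>0$. Here the proof for $A_\varepsilon\wedge B_\varepsilon$ derives an atom $0\le c - d\varepsilon$ with rational $c\le 0\le d$ not both zero (unsatisfiable for every $\varepsilon>0$). The proof-based interpolation method replaces every leaf atom $0\le t$ (resp. $0=t$) belonging to $B_\varepsilon$ by $0\le 0$ (resp. $0=0$), propagates the derivation with the same coefficients, and returns the single weak inequality at the root. -}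

module Defs where

open import Data.Rational using (ℚ; 0ℚ; 1ℚ; _+_; _*_; -_; _≤_; _<_; Positive)
open import Data.Nat using (ℕ; zero; suc)
open import Data.List using (List; []; _∷_; map)
open import Data.List.Membership.Propositional using (_∈_)
open import Data.List.Relation.Unary.All using (All)
open import Data.List.Relation.Unary.Any using (Any)
open import Data.Product using (_×_; _,_)
open import Data.Empty using (⊥)
open import Relation.Nullary using (¬_)
open import Relation.Binary.PropositionalEquality using (_≡_; _≢_)

-- Variables are natural numbers; a term
--   c + a₀ x₀ + a₁ x₁ + … + a_{k-1} x_{k-1}
-- is stored as its constant and its (dense) list of coefficients;
-- coefficients beyond the end of the list are 0.

record Term : Set where
  constructor term
  field
    const  : ℚ
    coeffs : List ℚ
open Term public

Assignment : Set
Assignment = ℕ → ℚ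

coeffAt : List ℚ → ℕ → ℚ
coeffAt []       _       = 0ℚ
coeffAt (a ∷ as) zero    = a
coeffAt (a ∷ as) (suc x) = coeffAt as x

coeff : Term → ℕ → ℚ
coeff t x = coeffAt (coeffs t) x

OccursT : ℕ → Term → Set
OccursT x t = coeff t x ≢ 0ℚ

evalCoeffs : Assignment → List ℚ → ℚ
evalCoeffs σ []       = 0ℚ
evalCoeffs σ (a ∷ as) = a * σ 0 + evalCoeffs (λ n → σ (suc n)) as

eval : Assignment → Term → ℚ
eval σ t = const t + evalCoeffs σ (coeffs t)

addCoeffs : List ℚ → List ℚ → List ℚ
addCoeffs []       bs       = bs
addCoeffs (a ∷ as) []       = a ∷ as
addCoeffs (a ∷ as) (b ∷ bs) = (a + b) ∷ addCoeffs as bs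

_+T_ : Term → Term → Term
s +T t = term (const s + const t) (addCoeffs (coeffs s) (coeffs t))

_·T_ : ℚ → Term → Term
c ·T t = term (c * const t) (map (c *_) (coeffs t))

-T_ : Term → Term
-T t = (- 1ℚ) ·T t

0T : Term
0T = term 0ℚ []

data Kind : Set where
  eqK leK ltK : Kind

record Atom : Set where
  constructor atom
  field
    kind : Kind
    tm   : Term
open Atom public

Sat : Assignment → Atom → Set
Sat σ (atom eqK t) = 0ℚ ≡ eval σ t
Sat σ (atom leK t) = 0ℚ ≤ eval σ t
Sat σ (atom ltK t) = 0ℚ < eval σ t

OccursA : ℕ → Atom → Set
OccursA x a = OccursT x (tm a)

Unsat : List Atom → Set
Unsat Γ = (σ : Assignment) → All (Sat σ) Γ → ⊥

Interpolant : List Atom → List Atom → Atom → Set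
Interpolant A B I =
    ((σ : Assignment) → All (Sat σ) A → Sat σ I)
  × ((σ : Assignment) → Sat σ I → All (Sat σ) B → ⊥)
  × ((x : ℕ) → OccursA x I → Any (OccursA x) A × Any (OccursA x) B)

-- Terms and atoms over the original variables plus the fresh symbol ε:
--   base + eps · ε

record ETerm : Set where
  constructor eterm
  field
    base : Term
    eps  : ℚ
open ETerm public

_+E_ : ETerm → ETerm → ETerm
s +E t = eterm (base s +T base t) (eps s + eps t)

_·E_ : ℚ → ETerm → ETerm
c ·E t = eterm (c ·T base t) (c * eps t)

-E_ : ETerm → ETerm
-E t = eterm (-T base t) (- eps t)

0E : ETerm
0E = eterm 0T 0ℚ

record EAtom : Set where
  constructor eatom
  field
    ekind : Kind
    etm   : ETerm
open EAtom public

-- Γ ↦ Γ_ε : each strict 0 < t becomes ε ≤ t, i.e. 0 ≤ t - ε;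
-- the other atoms are kept unchanged.
epsAtom : Atom → EAtom
epsAtom (atom eqK t) = eatom eqK (eterm t 0ℚ)
epsAtom (atom leK t) = eatom leK (eterm t 0ℚ)
epsAtom (atom ltK t) = eatom leK (eterm t (- 1ℚ))

epsList : List Atom → List EAtom
epsList = map epsAtom

data Side : Set where
  sideA sideB : Side

pick : Side → List EAtom → List EAtom → List EAtom
pick sideA Aε Bε = Aε
pick sideB Aε Bε = Bε

data LAProof (Aε Bε : List EAtom) : Set where
  hypLe : (s : Side) (t : ETerm) → eatom leK t ∈ pick s Aε Bε → LAProof Aε Bε
  eqPos : (s : Side) (t : ETerm) → eatom eqK t ∈ pick s Aε Bε → LAProof Aε Bε
  eqNeg : (s : Side) (t : ETerm) → eatom eqK t ∈ pick s Aε Bε → LAProof Aε Bε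
  comb  : (c₁ c₂ : ℚ) → Positive c₁ → Positive c₂ →
          LAProof Aε Bε → LAProof Aε Bε → LAProof Aε Bε

concl : ∀ {Aε Bε} → LAProof Aε Bε → ETerm
concl (hypLe s t _)          = t
concl (eqPos s t _)          = t
concl (eqNeg s t _)          = -E t
concl (comb c₁ c₂ _ _ p₁ p₂) = (c₁ ·E concl p₁) +E (c₂ ·E concl p₂)

-- the root derives 0 ≤ c - d ε with c ≤ 0 ≤ d, (c , d) ≠ (0 , 0):
-- no variable coefficient is non-zero, const = c, eps = - d.
RefutationRoot : ETerm → Set
RefutationRoot r =
    ((x : ℕ) → coeff (base r) x ≡ 0ℚ)
  × const (base r) ≤ 0ℚ
  × 0ℚ ≤ - eps r
  × ¬ (const (base r) ≡ 0ℚ × eps r ≡ 0ℚ)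

-- proof-based interpolation: B_ε-leaves 0 ≤ t / 0 = t are replaced by
-- 0 ≤ 0 / 0 = 0, the derivation is propagated with the same coefficients,
-- and the (term of the) root inequality 0 ≤ I is returned.
interpTerm : ∀ {Aε Bε} → LAProof Aε Bε → ETerm
interpTerm (hypLe sideA t _)      = t
interpTerm (hypLe sideB t _)      = 0E
interpTerm (eqPos sideA t _)      = t
interpTerm (eqPos sideB t _)      = 0E
interpTerm (eqNeg sideA t _)      = -E t
interpTerm (eqNeg sideB t _)      = -E 0E
interpTerm (comb c₁ c₂ _ _ p₁ p₂) = (c₁ ·E interpTerm p₁) +E (c₂ ·E interpTerm p₂)

-- Read ε as a positive infinitesimal, so that 0 ≤ v + e·ε means v > 0, or v = 0 and e ≥ 0
-- (LexNonNeg below).  Splitting every leaf of the refutation according to its side splits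
-- the root conclusion r as r = I + J, where I (the interpolant) is built from the A_ε-leaves
-- and J from the B_ε-leaves.  Each part is infinitesimally non-negative in every model of
-- its side, because LexNonNeg is closed under positive combinations and holds for every
-- atom of Γ_ε in a model of the corresponding atoms of Γ (0 < t makes t - ε infinitesimally
-- positive).  Since r = c - d·ε with c ≤ 0 ≤ d not both 0 is not LexNonNeg, no model of B
-- makes I LexNonNeg.  The ε-coefficient of I is ≤ 0: if it is 0, LexNonNeg I is just 0 ≤ I;
-- if it is -c < 0, LexNonNeg I is 0 < I.  Variables of I occur in A, and since the
-- coefficients of I + J all vanish, also in J, hence in B.
module Submission where

open import Defs
open import Data.Rational using (ℚ; 0ℚ; -_; Positive)
open import Data.List using (List; _++_)
open import Data.Product using (Σ; _×_)
open import Relation.Binary.PropositionalEquality using (_≡_; _≢_)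

open import Algebra.Bundles using (CommutativeMonoid)
open import Data.Empty using (⊥; ⊥-elim)
open import Data.List using ([]; _∷_; map)
open import Data.List.Membership.Propositional using (_∈_; lose)
open import Data.List.Membership.Propositional.Properties using (∈-map⁻)
open import Data.List.Relation.Unary.All as All using (All)
open import Data.List.Relation.Unary.Any using (Any)
open import Data.Nat using (ℕ; zero; suc)
open import Data.Product using (_,_; proj₁; proj₂)
open import Data.Rational using (1ℚ; _+_; _*_; _≤_; _<_; _≟_; positive)
open import Data.Rational.Properties
  using (+-identityˡ; +-identityʳ; *-assoc; *-zeroˡ; *-zeroʳ; *-distribˡ-+; *-distribʳ-+;
         ≤-refl; ≤-reflexive; ≤-antisym; <⇒≤; <-irrefl; <-≤-trans; <-cmp; +-mono-≤; +-mono-<;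
         *-monoʳ-<-pos; *-monoˡ-≤-nonNeg; pos⇒nonNeg; negative⁻¹; neg-antimono-≤; neg-antimono-<;
         +-0-commutativeMonoid; +-0-group)
open import Data.Sum using (_⊎_; inj₁; inj₂)
open import Relation.Binary.Definitions using (tri<; tri≈; tri>)
open import Relation.Binary.PropositionalEquality using (refl; sym; trans; cong; cong₂; subst; subst₂)
open import Relation.Nullary using (¬_; yes; no)
open import Algebra.Properties.CommutativeSemigroup
  (CommutativeMonoid.commutativeSemigroup +-0-commutativeMonoid) using (interchange)
open import Algebra.Properties.Group +-0-group using (⁻¹-involutive)
open Relation.Binary.PropositionalEquality.≡-Reasoning

evalCoeffs-addCoeffs : ∀ σ as bs →
  evalCoeffs σ (addCoeffs as bs) ≡ evalCoeffs σ as + evalCoeffs σ bs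
evalCoeffs-addCoeffs σ []       bs       = sym (+-identityˡ _)
evalCoeffs-addCoeffs σ (a ∷ as) []       = sym (+-identityʳ _)
evalCoeffs-addCoeffs σ (a ∷ as) (b ∷ bs) = begin
  (a + b) * σ 0 + evalCoeffs σ′ (addCoeffs as bs)
    ≡⟨ cong₂ _+_ (*-distribʳ-+ (σ 0) a b) (evalCoeffs-addCoeffs σ′ as bs) ⟩
  (a * σ 0 + b * σ 0) + (evalCoeffs σ′ as + evalCoeffs σ′ bs)
    ≡⟨ interchange (a * σ 0) (b * σ 0) (evalCoeffs σ′ as) (evalCoeffs σ′ bs) ⟩
  (a * σ 0 + evalCoeffs σ′ as) + (b * σ 0 + evalCoeffs σ′ bs) ∎
  where σ′ = λ n → σ (suc n)

evalCoeffs-map-* : ∀ σ c as → evalCoeffs σ (map (c *_) as) ≡ c * evalCoeffs σ as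
evalCoeffs-map-* σ c []       = sym (*-zeroʳ c)
evalCoeffs-map-* σ c (a ∷ as) = begin
  c * a * σ 0 + evalCoeffs σ′ (map (c *_) as)
    ≡⟨ cong₂ _+_ (*-assoc c a (σ 0)) (evalCoeffs-map-* σ′ c as) ⟩
  c * (a * σ 0) + c * evalCoeffs σ′ as
    ≡⟨ *-distribˡ-+ c _ _ ⟨
  c * (a * σ 0 + evalCoeffs σ′ as) ∎
  where σ′ = λ n → σ (suc n)

evalCoeffs-zeros : ∀ σ as → (∀ x → coeffAt as x ≡ 0ℚ) → evalCoeffs σ as ≡ 0ℚ
evalCoeffs-zeros σ []       zeros = refl
evalCoeffs-zeros σ (a ∷ as) zeros = begin
  a * σ 0 + evalCoeffs (λ n → σ (suc n)) as
    ≡⟨ cong₂ (λ u v → u * σ 0 + v) (zeros 0)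
         (evalCoeffs-zeros (λ n → σ (suc n)) as (λ x → zeros (suc x))) ⟩
  0ℚ * σ 0 + 0ℚ
    ≡⟨ cong (_+ 0ℚ) (*-zeroˡ (σ 0)) ⟩
  0ℚ ∎

evalCoeffs-cong : ∀ σ as bs → (∀ x → coeffAt as x ≡ coeffAt bs x) →
  evalCoeffs σ as ≡ evalCoeffs σ bs
evalCoeffs-cong σ []       []       eq = refl
evalCoeffs-cong σ []       (b ∷ bs) eq = sym (evalCoeffs-zeros σ (b ∷ bs) (λ x → sym (eq x)))
evalCoeffs-cong σ (a ∷ as) []       eq = evalCoeffs-zeros σ (a ∷ as) eq
evalCoeffs-cong σ (a ∷ as) (b ∷ bs) eq =
  cong₂ (λ u v → u * σ 0 + v) (eq 0)
        (evalCoeffs-cong (λ n → σ (suc n)) as bs (λ x → eq (suc x)))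

coeffAt-addCoeffs : ∀ as bs x → coeffAt (addCoeffs as bs) x ≡ coeffAt as x + coeffAt bs x
coeffAt-addCoeffs []       bs       x       = sym (+-identityˡ _)
coeffAt-addCoeffs (a ∷ as) []       x       = sym (+-identityʳ _)
coeffAt-addCoeffs (a ∷ as) (b ∷ bs) zero    = refl
coeffAt-addCoeffs (a ∷ as) (b ∷ bs) (suc x) = coeffAt-addCoeffs as bs x

coeffAt-map-* : ∀ c as x → coeffAt (map (c *_) as) x ≡ c * coeffAt as x
coeffAt-map-* c []       x       = sym (*-zeroʳ c)
coeffAt-map-* c (a ∷ as) zero    = refl
coeffAt-map-* c (a ∷ as) (suc x) = coeffAt-map-* c as x

eval-+T : ∀ σ s t → eval σ (s +T t) ≡ eval σ s + eval σ t
eval-+T σ s t = trans (cong (const s + const t +_) (evalCoeffs-addCoeffs σ (coeffs s) (coeffs t)))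
                      (interchange (const s) (const t) _ _)

eval-·T : ∀ σ c t → eval σ (c ·T t) ≡ c * eval σ t
eval-·T σ c t = trans (cong (c * const t +_) (evalCoeffs-map-* σ c (coeffs t)))
                      (sym (*-distribˡ-+ c _ _))

eval-constant : ∀ σ t → (∀ x → coeff t x ≡ 0ℚ) → eval σ t ≡ const t
eval-constant σ t zero-coeffs =
  trans (cong (const t +_) (evalCoeffs-zeros σ (coeffs t) zero-coeffs)) (+-identityʳ _)

data Coord : Set where
  constant epsilon : Coord
  var              : ℕ → Coord

_at_ : ETerm → Coord → ℚ
t at constant = const (base t)
t at epsilon  = eps t
t at var x    = coeff (base t) x

_≈E_ : ETerm → ETerm → Set
s ≈E t = ∀ k → s at k ≡ t at k

at-0E : ∀ k → 0E at k ≡ 0ℚ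
at-0E constant = refl
at-0E epsilon  = refl
at-0E (var x)  = refl

at-+E : ∀ s t k → (s +E t) at k ≡ s at k + t at k
at-+E s t constant = refl
at-+E s t epsilon  = refl
at-+E s t (var x)  = coeffAt-addCoeffs (coeffs (base s)) (coeffs (base t)) x

at-·E : ∀ c t k → (c ·E t) at k ≡ c * (t at k)
at-·E c t constant = refl
at-·E c t epsilon  = refl
at-·E c t (var x)  = coeffAt-map-* c (coeffs (base t)) x

at-comb : ∀ c₁ c₂ s t k →
  ((c₁ ·E s) +E (c₂ ·E t)) at k ≡ c₁ * (s at k) + c₂ * (t at k)
at-comb c₁ c₂ s t k =
  trans (at-+E (c₁ ·E s) (c₂ ·E t) k) (cong₂ _+_ (at-·E c₁ s k) (at-·E c₂ t k))

eval-cong : ∀ σ {s t} → s ≈E t → eval σ (base s) ≡ eval σ (base t)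
eval-cong σ {s} {t} s≈t =
  cong₂ _+_ (s≈t constant) (evalCoeffs-cong σ (coeffs (base s)) (coeffs (base t)) (λ x → s≈t (var x)))

eval-comb : ∀ σ c₁ c₂ s t →
  eval σ (base ((c₁ ·E s) +E (c₂ ·E t))) ≡ c₁ * eval σ (base s) + c₂ * eval σ (base t)
eval-comb σ c₁ c₂ s t = trans (eval-+T σ (c₁ ·T base s) (c₂ ·T base t))
                              (cong₂ _+_ (eval-·T σ c₁ (base s)) (eval-·T σ c₂ (base t)))

≤∧≢⇒< : ∀ {p q} → p ≤ q → p ≢ q → p < q
≤∧≢⇒< {p} {q} p≤q p≢q with <-cmp p q
... | tri< p<q _ _ = p<q
... | tri≈ _ p≡q _ = ⊥-elim (p≢q p≡q)
... | tri> _ _ q<p = ⊥-elim (<-irrefl refl (<-≤-trans q<p p≤q))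

LexNonNeg : ℚ → ℚ → Set
LexNonNeg v e = 0ℚ < v ⊎ (v ≡ 0ℚ × 0ℚ ≤ e)

≤⇒LexNonNeg : ∀ {v e} → 0ℚ ≤ v → 0ℚ ≤ e → LexNonNeg v e
≤⇒LexNonNeg {v} 0≤v 0≤e with <-cmp 0ℚ v
... | tri< 0<v _ _ = inj₁ 0<v
... | tri≈ _ 0≡v _ = inj₂ (sym 0≡v , 0≤e)
... | tri> _ _ v<0 = ⊥-elim (<-irrefl refl (<-≤-trans v<0 0≤v))

LexNonNeg⇒≤ : ∀ {v e} → LexNonNeg v e → 0ℚ ≤ v
LexNonNeg⇒≤ (inj₁ 0<v)      = <⇒≤ 0<v
LexNonNeg⇒≤ (inj₂ (v≡0 , _)) = ≤-reflexive (sym v≡0)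

LexNonNeg⇒< : ∀ {v e} → e < 0ℚ → LexNonNeg v e → 0ℚ < v
LexNonNeg⇒< e<0 (inj₁ 0<v)       = 0<v
LexNonNeg⇒< e<0 (inj₂ (_ , 0≤e)) = ⊥-elim (<-irrefl refl (<-≤-trans e<0 0≤e))

LexNonNeg-scale : ∀ c → Positive c → ∀ {v e} → LexNonNeg v e → LexNonNeg (c * v) (c * e)
LexNonNeg-scale c c>0 (inj₁ 0<v) =
  inj₁ (subst (_< c * _) (*-zeroʳ c) (*-monoʳ-<-pos c {{c>0}} 0<v))
LexNonNeg-scale c c>0 (inj₂ (refl , 0≤e)) =
  inj₂ (*-zeroʳ c , subst (_≤ c * _) (*-zeroʳ c) (*-monoˡ-≤-nonNeg c {{pos⇒nonNeg c {{c>0}}}} 0≤e))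

LexNonNeg-+ : ∀ {v₁ e₁ v₂ e₂} → LexNonNeg v₁ e₁ → LexNonNeg v₂ e₂ → LexNonNeg (v₁ + v₂) (e₁ + e₂)
LexNonNeg-+ (inj₁ p)            (inj₁ q)            = inj₁ (+-mono-< p q)
LexNonNeg-+ (inj₁ p)            (inj₂ (refl , _))   = inj₁ (subst (0ℚ <_) (sym (+-identityʳ _)) p)
LexNonNeg-+ (inj₂ (refl , _))   (inj₁ q)            = inj₁ (subst (0ℚ <_) (sym (+-identityˡ _)) q)
LexNonNeg-+ (inj₂ (refl , p))   (inj₂ (refl , q))   = inj₂ (refl , +-mono-≤ p q)

LexNonNeg-comb : ∀ c₁ c₂ {v₁ e₁ v₂ e₂} → Positive c₁ → Positive c₂ →
  LexNonNeg v₁ e₁ → LexNonNeg v₂ e₂ → LexNonNeg (c₁ * v₁ + c₂ * v₂) (c₁ * e₁ + c₂ * e₂)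
LexNonNeg-comb c₁ c₂ c₁>0 c₂>0 l₁ l₂ =
  LexNonNeg-+ (LexNonNeg-scale c₁ c₁>0 l₁) (LexNonNeg-scale c₂ c₂>0 l₂)

≤0-comb : ∀ c₁ c₂ {e₁ e₂} → Positive c₁ → Positive c₂ →
  e₁ ≤ 0ℚ → e₂ ≤ 0ℚ → c₁ * e₁ + c₂ * e₂ ≤ 0ℚ
≤0-comb c₁ c₂ c₁>0 c₂>0 e₁≤0 e₂≤0 = +-mono-≤ (scale c₁ c₁>0 e₁≤0) (scale c₂ c₂>0 e₂≤0)
  where
  scale : ∀ c → Positive c → ∀ {e} → e ≤ 0ℚ → c * e ≤ 0ℚ
  scale c c>0 {e} e≤0 = subst (c * e ≤_) (*-zeroʳ c) (*-monoˡ-≤-nonNeg c {{pos⇒nonNeg c {{c>0}}}} e≤0)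

RefutationRoot⇒¬LexNonNeg : ∀ σ r → RefutationRoot r → ¬ LexNonNeg (eval σ (base r)) (eps r)
RefutationRoot⇒¬LexNonNeg σ r (zero-coeffs , c≤0 , 0≤d , nontrivial) lnn
  with subst (λ v → LexNonNeg v (eps r)) (eval-constant σ (base r) zero-coeffs) lnn
... | inj₁ 0<c           = <-irrefl refl (<-≤-trans 0<c c≤0)
... | inj₂ (c≡0 , 0≤eps) = nontrivial (c≡0 , ≤-antisym eps≤0 0≤eps)
  where
  eps≤0 : eps r ≤ 0ℚ
  eps≤0 = subst (_≤ 0ℚ) (⁻¹-involutive (eps r)) (neg-antimono-≤ 0≤d)

side : Side → List Atom → List Atom → List Atom
side sideA A B = A
side sideB A B = B

pick-epsList : ∀ s A B → pick s (epsList A) (epsList B) ≡ epsList (side s A B)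
pick-epsList sideA A B = refl
pick-epsList sideB A B = refl

keepOn : Side → Side → ETerm → ETerm
keepOn sideA sideA t = t
keepOn sideB sideB t = t
keepOn _     _     t = 0E

keepOn-elim : ∀ (Q : ETerm → Set) s s′ t → Q 0E → (s ≡ s′ → Q t) → Q (keepOn s s′ t)
keepOn-elim Q sideA sideA t q₀ q = q refl
keepOn-elim Q sideA sideB t q₀ q = q₀
keepOn-elim Q sideB sideA t q₀ q = q₀
keepOn-elim Q sideB sideB t q₀ q = q refl

sidePart : ∀ {Aε Bε} → Side → LAProof Aε Bε → ETerm
sidePart s (hypLe s′ t _)          = keepOn s s′ t
sidePart s (eqPos s′ t _)          = keepOn s s′ t
sidePart s (eqNeg s′ t _)          = keepOn s s′ (-E t)
sidePart s (comb c₁ c₂ _ _ P₁ P₂) = (c₁ ·E sidePart s P₁) +E (c₂ ·E sidePart s P₂)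

interpTerm≡sidePartA : ∀ {Aε Bε} (P : LAProof Aε Bε) → interpTerm P ≡ sidePart sideA P
interpTerm≡sidePartA (hypLe sideA t _)        = refl
interpTerm≡sidePartA (hypLe sideB t _)        = refl
interpTerm≡sidePartA (eqPos sideA t _)        = refl
interpTerm≡sidePartA (eqPos sideB t _)        = refl
interpTerm≡sidePartA (eqNeg sideA t _)        = refl
interpTerm≡sidePartA (eqNeg sideB t _)        = refl
interpTerm≡sidePartA (comb c₁ c₂ _ _ P₁ P₂) =
  cong₂ (λ u v → (c₁ ·E u) +E (c₂ ·E v)) (interpTerm≡sidePartA P₁) (interpTerm≡sidePartA P₂)

keepOn-split : ∀ s′ t → t ≈E (keepOn sideA s′ t +E keepOn sideB s′ t)
keepOn-split sideA t k = sym (trans (at-+E t 0E k) (trans (cong (t at k +_) (at-0E k)) (+-identityʳ _)))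
keepOn-split sideB t k = sym (trans (at-+E 0E t k) (trans (cong (_+ t at k) (at-0E k)) (+-identityˡ _)))

concl≈sideParts : ∀ {Aε Bε} (P : LAProof Aε Bε) → concl P ≈E (sidePart sideA P +E sidePart sideB P)
concl≈sideParts (hypLe s′ t _) = keepOn-split s′ t
concl≈sideParts (eqPos s′ t _) = keepOn-split s′ t
concl≈sideParts (eqNeg s′ t _) = keepOn-split s′ (-E t)
concl≈sideParts (comb c₁ c₂ _ _ P₁ P₂) k = begin
  ((c₁ ·E concl P₁) +E (c₂ ·E concl P₂)) at k
    ≡⟨ at-comb c₁ c₂ (concl P₁) (concl P₂) k ⟩
  c₁ * (concl P₁ at k) + c₂ * (concl P₂ at k)
    ≡⟨ cong₂ (λ u v → c₁ * u + c₂ * v)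
         (trans (concl≈sideParts P₁ k) (at-+E I₁ J₁ k)) (trans (concl≈sideParts P₂ k) (at-+E I₂ J₂ k)) ⟩
  c₁ * (I₁ at k + J₁ at k) + c₂ * (I₂ at k + J₂ at k)
    ≡⟨ cong₂ _+_ (*-distribˡ-+ c₁ _ _) (*-distribˡ-+ c₂ _ _) ⟩
  (c₁ * (I₁ at k) + c₁ * (J₁ at k)) + (c₂ * (I₂ at k) + c₂ * (J₂ at k))
    ≡⟨ interchange (c₁ * (I₁ at k)) (c₁ * (J₁ at k)) (c₂ * (I₂ at k)) (c₂ * (J₂ at k)) ⟩
  (c₁ * (I₁ at k) + c₂ * (I₂ at k)) + (c₁ * (J₁ at k) + c₂ * (J₂ at k))
    ≡⟨ cong₂ _+_ (at-comb c₁ c₂ I₁ I₂ k) (at-comb c₁ c₂ J₁ J₂ k) ⟨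
  ((c₁ ·E I₁) +E (c₂ ·E I₂)) at k + ((c₁ ·E J₁) +E (c₂ ·E J₂)) at k
    ≡⟨ at-+E ((c₁ ·E I₁) +E (c₂ ·E I₂)) ((c₁ ·E J₁) +E (c₂ ·E J₂)) k ⟨
  (((c₁ ·E I₁) +E (c₂ ·E I₂)) +E ((c₁ ·E J₁) +E (c₂ ·E J₂))) at k ∎
  where
  I₁ = sidePart sideA P₁
  J₁ = sidePart sideB P₁
  I₂ = sidePart sideA P₂
  J₂ = sidePart sideB P₂

module _ {A B : List Atom} (s : Side) (Q : ETerm → Set)
  (Q-0E   : Q 0E)
  (Q-comb : ∀ c₁ c₂ {t₁ t₂} → Positive c₁ → Positive c₂ → Q t₁ → Q t₂ →
            Q ((c₁ ·E t₁) +E (c₂ ·E t₂)))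
  (Q-le   : ∀ {u} → atom leK u ∈ side s A B → Q (eterm u 0ℚ))
  (Q-lt   : ∀ {u} → atom ltK u ∈ side s A B → Q (eterm u (- 1ℚ)))
  (Q-eq   : ∀ {u} → atom eqK u ∈ side s A B → Q (eterm u 0ℚ) × Q (-E eterm u 0ℚ))
  where

  private
    onSide : ∀ {k t} s′ → eatom k t ∈ pick s′ (epsList A) (epsList B) → s ≡ s′ →
             eatom k t ∈ epsList (side s A B)
    onSide s′ m refl = subst (_ ∈_) (pick-epsList s A B) m

    leLeaf : ∀ {t} → eatom leK t ∈ epsList (side s A B) → Q t
    leLeaf m with ∈-map⁻ epsAtom m
    ... | atom eqK u , _  , ()
    ... | atom leK u , u∈ , refl = Q-le u∈
    ... | atom ltK u , u∈ , refl = Q-lt u∈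

    eqLeaf : ∀ {t} → eatom eqK t ∈ epsList (side s A B) → Q t × Q (-E t)
    eqLeaf m with ∈-map⁻ epsAtom m
    ... | atom eqK u , u∈ , refl = Q-eq u∈
    ... | atom leK u , _  , ()
    ... | atom ltK u , _  , ()

  sidePart-ind : (P : LAProof (epsList A) (epsList B)) → Q (sidePart s P)
  sidePart-ind (hypLe s′ t m) =
    keepOn-elim Q s s′ t Q-0E (λ s≡s′ → leLeaf (onSide s′ m s≡s′))
  sidePart-ind (eqPos s′ t m) =
    keepOn-elim Q s s′ t Q-0E (λ s≡s′ → proj₁ (eqLeaf (onSide s′ m s≡s′)))
  sidePart-ind (eqNeg s′ t m) =
    keepOn-elim Q s s′ (-E t) Q-0E (λ s≡s′ → proj₂ (eqLeaf (onSide s′ m s≡s′)))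
  sidePart-ind (comb c₁ c₂ c₁>0 c₂>0 P₁ P₂) =
    Q-comb c₁ c₂ c₁>0 c₂>0 (sidePart-ind P₁) (sidePart-ind P₂)

module _ {A B : List Atom} where

  sidePart-eps≤0 : ∀ s (P : LAProof (epsList A) (epsList B)) → eps (sidePart s P) ≤ 0ℚ
  sidePart-eps≤0 s = sidePart-ind s (λ t → eps t ≤ 0ℚ)
    ≤-refl (λ c₁ c₂ → ≤0-comb c₁ c₂)
    (λ _ → ≤-refl) (λ _ → <⇒≤ (negative⁻¹ (- 1ℚ))) (λ _ → ≤-refl , ≤-refl)

  sidePart-LexNonNeg : ∀ s σ → All (Sat σ) (side s A B) → (P : LAProof (epsList A) (epsList B)) →
    LexNonNeg (eval σ (base (sidePart s P))) (eps (sidePart s P))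
  sidePart-LexNonNeg s σ sat = sidePart-ind s (λ t → LexNonNeg (eval σ (base t)) (eps t))
    (inj₂ (refl , ≤-refl)) combined
    (λ u∈ → ≤⇒LexNonNeg (All.lookup sat u∈) ≤-refl) (λ u∈ → inj₁ (All.lookup sat u∈))
    (λ {u} u∈ → inj₂ (sym (All.lookup sat u∈) , ≤-refl) , inj₂ (negated-zero u (All.lookup sat u∈) , ≤-refl))
    where
    combined : ∀ c₁ c₂ {t₁ t₂} → Positive c₁ → Positive c₂ →
      LexNonNeg (eval σ (base t₁)) (eps t₁) → LexNonNeg (eval σ (base t₂)) (eps t₂) →
      LexNonNeg (eval σ (base ((c₁ ·E t₁) +E (c₂ ·E t₂)))) (eps ((c₁ ·E t₁) +E (c₂ ·E t₂)))
    combined c₁ c₂ {t₁} {t₂} c₁>0 c₂>0 l₁ l₂ =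
      subst (λ v → LexNonNeg v _) (sym (eval-comb σ c₁ c₂ t₁ t₂)) (LexNonNeg-comb c₁ c₂ c₁>0 c₂>0 l₁ l₂)

    negated-zero : ∀ u → 0ℚ ≡ eval σ u → eval σ (-T u) ≡ 0ℚ
    negated-zero u 0≡u = trans (eval-·T σ (- 1ℚ) u) (trans (cong (- 1ℚ *_) (sym 0≡u)) (*-zeroʳ (- 1ℚ)))

  sidePart-vars : ∀ s (P : LAProof (epsList A) (epsList B)) x →
    OccursT x (base (sidePart s P)) → Any (OccursA x) (side s A B)
  sidePart-vars s P x = sidePart-ind s (λ t → OccursT x (base t) → Any (OccursA x) (side s A B))
    (λ nz → ⊥-elim (nz refl)) combined
    (λ u∈ → lose u∈) (λ u∈ → lose u∈)
    (λ {u} u∈ → lose u∈ , λ nz → lose u∈ (λ u≡0 → nz (negated-zero u u≡0))) P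
    where
    combined : ∀ c₁ c₂ {t₁ t₂} → Positive c₁ → Positive c₂ →
      (OccursT x (base t₁) → Any (OccursA x) (side s A B)) →
      (OccursT x (base t₂) → Any (OccursA x) (side s A B)) →
      OccursT x (base ((c₁ ·E t₁) +E (c₂ ·E t₂))) → Any (OccursA x) (side s A B)
    combined c₁ c₂ {t₁} {t₂} _ _ occ₁ occ₂ nz with coeff (base t₁) x ≟ 0ℚ
    ... | no  t₁≢0 = occ₁ t₁≢0
    ... | yes t₁≡0 = occ₂ λ t₂≡0 → nz (begin
      coeff (base ((c₁ ·E t₁) +E (c₂ ·E t₂))) x ≡⟨ at-comb c₁ c₂ t₁ t₂ (var x) ⟩
      c₁ * coeff (base t₁) x + c₂ * coeff (base t₂) x ≡⟨ cong₂ (λ u v → c₁ * u + c₂ * v) t₁≡0 t₂≡0 ⟩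
      c₁ * 0ℚ + c₂ * 0ℚ                              ≡⟨ cong₂ _+_ (*-zeroʳ c₁) (*-zeroʳ c₂) ⟩
      0ℚ                                              ∎)

    negated-zero : ∀ u → coeff u x ≡ 0ℚ → coeff (-T u) x ≡ 0ℚ
    negated-zero u u≡0 =
      trans (coeffAt-map-* (- 1ℚ) (coeffs u) x) (trans (cong (- 1ℚ *_) u≡0) (*-zeroʳ (- 1ℚ)))

module _ {A B : List Atom} (P : LAProof (epsList A) (epsList B)) (root : RefutationRoot (concl P)) where

  private
    I J : ETerm
    I = sidePart sideA P
    J = sidePart sideB P

  sidePartA∧B-unsat : ∀ σ → LexNonNeg (eval σ (base I)) (eps I) → All (Sat σ) B → ⊥
  sidePartA∧B-unsat σ lnnI satB =
    RefutationRoot⇒¬LexNonNeg σ (concl P) root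
      (subst₂ LexNonNeg (sym eval-r) (sym (concl≈sideParts P epsilon))
        (LexNonNeg-+ lnnI (sidePart-LexNonNeg sideB σ satB P)))
    where
    eval-r : eval σ (base (concl P)) ≡ eval σ (base I) + eval σ (base J)
    eval-r = trans (eval-cong σ (concl≈sideParts P)) (eval-+T σ (base I) (base J))

  sidePartA-shared : ∀ x → OccursT x (base I) → Any (OccursA x) A × Any (OccursA x) B
  sidePartA-shared x I≢0 = sidePart-vars sideA P x I≢0 , sidePart-vars sideB P x J≢0
    where
    J≢0 : OccursT x (base J)
    J≢0 J≡0 = I≢0 (begin
      coeff (base I) x                    ≡⟨ +-identityʳ _ ⟨
      coeff (base I) x + 0ℚ               ≡⟨ cong (coeff (base I) x +_) J≡0 ⟨
      coeff (base I) x + coeff (base J) x ≡⟨ at-+E I J (var x) ⟨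
      (I +E J) at var x                   ≡⟨ concl≈sideParts P (var x) ⟨
      coeff (base (concl P)) x            ≡⟨ proj₁ root x ⟩
      0ℚ                                  ∎)

mainTheorem3 : (A B : List Atom) → Unsat (A ++ B) →
    (P : LAProof (epsList A) (epsList B)) → RefutationRoot (concl P) →
      ((eps (interpTerm P) ≡ 0ℚ) → Interpolant A B (atom leK (base (interpTerm P))))
    × ((eps (interpTerm P) ≢ 0ℚ) →
         Σ ℚ (λ c → Positive c × eps (interpTerm P) ≡ - c
                    × Interpolant A B (atom ltK (base (interpTerm P)))))
mainTheorem3 A B _ P root rewrite interpTerm≡sidePartA P = weak , strict
  where
  I : ETerm
  I = sidePart sideA P

  A⊨I : ∀ σ → All (Sat σ) A → LexNonNeg (eval σ (base I)) (eps I)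
  A⊨I σ satA = sidePart-LexNonNeg sideA σ satA P

  weak : eps I ≡ 0ℚ → Interpolant A B (atom leK (base I))
  weak eps≡0 = (λ σ satA → LexNonNeg⇒≤ (A⊨I σ satA))
             , (λ σ 0≤I → sidePartA∧B-unsat P root σ (≤⇒LexNonNeg 0≤I (≤-reflexive (sym eps≡0))))
             , sidePartA-shared P root

  strict : eps I ≢ 0ℚ → Σ ℚ (λ c → Positive c × eps I ≡ - c × Interpolant A B (atom ltK (base I)))
  strict eps≢0 = - eps I , positive (neg-antimono-< eps<0) , sym (⁻¹-involutive (eps I))
               , (λ σ satA → LexNonNeg⇒< eps<0 (A⊨I σ satA))
               , (λ σ 0<I → sidePartA∧B-unsat P root σ (inj₁ 0<I))
               , sidePartA-shared P root
    where
    eps<0 : eps I < 0ℚ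
    eps<0 = ≤∧≢⇒< (sidePart-eps≤0 sideA P) eps≢0
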